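{- Let $S$ and $T$ be finite subsets of $\mathbb{Z}$ with $|S|=|T|$, and let $f:S\to T$ be the order-preserving bijection. Then the extension $\tilde f:\mathcal{W}_S\to\mathcal{W}_T$ induces a bijection $\mathcal{W}_S/\approx\ \to\ \mathcal{W}_T/\approx$.
   Context: A well-tempered scoring game is defined recursively: an even-tempered game is either an integer or a pair $\{G^L|G^R\}$ with finite nonempty sets of odd-tempered left and right options; an odd-tempered game is a pair $\{G^L|G^R\}$ with finite nonempty sets of even-tempered options. Integers have no options. Subgames: $G$ and subgames of its options; $G$ is $S$-valued if every integer subgame lies in $S$, and $\mathcal{W}_S$ is the class of $S$-valued games. Outcomes: $\operatorname{L}(n)=\operatorname{R}(n)=n$ for integers, otherwise $\operatorname{L}(G)=\max_{G^L}\operatorname{R}(G^L)$, $\operatorname{R}(G)=\min_{G^R}\operatorname{L}(G^R)$. Disjunctive sum: integer sum if both are integers, else $G+H=\{G^L+H,G+H^L\mid G^R+H,G+H^R\}$. $G\approx H$ iff $\operatorname{L}(G+X)=\operatorname{L}(H+X)$ and $\operatorname{R}(G+X)=\operatorname{R}(H+X)$ for every well-tempered scoring game $X$. The extension of $f:S\to T$ to games is $\tilde f(n)=f(n)$ for integers $n$ and $\tilde f(\{G^L|G^R\})=\{\tilde f(G^L)|\tilde f(G^R)\}$. -}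

module Defs where

open import Data.Integer using (ℤ; _<_) renaming (_+_ to _+ℤ_)
open import Data.Integer.Base using (_⊔_; _⊓_)
open import Data.List using (List; []; _∷_; length)
open import Data.List.NonEmpty using (List⁺; _∷_; toList)
open import Data.List.Relation.Unary.All using (All)
open import Data.List.Relation.Unary.Unique.Propositional using (Unique)
open import Data.List.Membership.Propositional using (_∈_)
open import Data.Product using (_×_; Σ; ∃)
open import Relation.Binary.PropositionalEquality using (_≡_)

data Temper : Set where
  even odd : Temper

flip : Temper → Temper
flip even = odd
flip odd  = even

_⊕_ : Temper → Temper → Temper
even ⊕ q = q
odd  ⊕ q = flip q

-- Well-tempered scoring games, indexed by temper.  The finite nonempty
-- sets of options are represented by nonempty lists.
data Game : Temper → Set where
  int   : ℤ → Game even
  nodeE : List⁺ (Game odd)  → List⁺ (Game odd)  → Game even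
  nodeO : List⁺ (Game even) → List⁺ (Game even) → Game odd

mutual
  Lo : ∀ {p} → Game p → ℤ
  Lo (int n)       = n
  Lo (nodeE ls rs) = maxR ls
  Lo (nodeO ls rs) = maxR ls

  Ro : ∀ {p} → Game p → ℤ
  Ro (int n)       = n
  Ro (nodeE ls rs) = minL rs
  Ro (nodeO ls rs) = minL rs

  maxR : ∀ {p} → List⁺ (Game p) → ℤ
  maxR (g ∷ gs) = maxR' (Ro g) gs

  maxR' : ∀ {p} → ℤ → List (Game p) → ℤ
  maxR' acc []       = acc
  maxR' acc (g ∷ gs) = maxR' (acc ⊔ Ro g) gs

  minL : ∀ {p} → List⁺ (Game p) → ℤ
  minL (g ∷ gs) = minL' (Lo g) gs

  minL' : ∀ {p} → ℤ → List (Game p) → ℤ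
  minL' acc []       = acc
  minL' acc (g ∷ gs) = minL' (acc ⊓ Lo g) gs

mutual
  _+G_ : ∀ {p q} → Game p → Game q → Game (p ⊕ q)
  int m       +G int n       = int (m +ℤ n)
  int m       +G nodeE ls rs = nodeE (mapʳ (int m) ls) (mapʳ (int m) rs)
  int m       +G nodeO ls rs = nodeO (mapʳ (int m) ls) (mapʳ (int m) rs)
  nodeE ls rs +G int n       = nodeE (mapˡ ls (int n)) (mapˡ rs (int n))
  nodeE ls rs +G nodeE ks ts =
    nodeE (mapˡ ls (nodeE ks ts) ⁺++⁺ mapʳ (nodeE ls rs) ks)
          (mapˡ rs (nodeE ks ts) ⁺++⁺ mapʳ (nodeE ls rs) ts)
  nodeE ls rs +G nodeO ks ts =
    nodeO (mapˡ ls (nodeO ks ts) ⁺++⁺ mapʳ (nodeE ls rs) ks)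
          (mapˡ rs (nodeO ks ts) ⁺++⁺ mapʳ (nodeE ls rs) ts)
  nodeO ls rs +G int n       = nodeO (mapˡ ls (int n)) (mapˡ rs (int n))
  nodeO ls rs +G nodeE ks ts =
    nodeO (mapˡ ls (nodeE ks ts) ⁺++⁺ mapʳ (nodeO ls rs) ks)
          (mapˡ rs (nodeE ks ts) ⁺++⁺ mapʳ (nodeO ls rs) ts)
  nodeO ls rs +G nodeO ks ts =
    nodeE (mapˡ ls (nodeO ks ts) ⁺++⁺ mapʳ (nodeO ls rs) ks)
          (mapˡ rs (nodeO ks ts) ⁺++⁺ mapʳ (nodeO ls rs) ts)

  mapˡ : ∀ {p q} → List⁺ (Game p) → Game q → List⁺ (Game (p ⊕ q))
  mapˡ (g ∷ gs) h = (g +G h) ∷ mapˡ' gs h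

  mapˡ' : ∀ {p q} → List (Game p) → Game q → List (Game (p ⊕ q))
  mapˡ' []       h = []
  mapˡ' (g ∷ gs) h = (g +G h) ∷ mapˡ' gs h

  mapʳ : ∀ {p q} → Game p → List⁺ (Game q) → List⁺ (Game (p ⊕ q))
  mapʳ g (h ∷ hs) = (g +G h) ∷ mapʳ' g hs

  mapʳ' : ∀ {p q} → Game p → List (Game q) → List (Game (p ⊕ q))
  mapʳ' g []       = []
  mapʳ' g (h ∷ hs) = (g +G h) ∷ mapʳ' g hs

  _⁺++⁺_ : ∀ {A : Set} → List⁺ A → List⁺ A → List⁺ A
  (x ∷ xs) ⁺++⁺ (y ∷ ys) = x ∷ (xs Data.List.++ (y ∷ ys))

_≈G_ : ∀ {p q} → Game p → Game q → Set
G ≈G H = ∀ {r} (X : Game r) →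
  (Lo (G +G X) ≡ Lo (H +G X)) × (Ro (G +G X) ≡ Ro (H +G X))

data Valued (S : List ℤ) : ∀ {p} → Game p → Set where
  vint  : ∀ {n} → n ∈ S → Valued S (int n)
  vnodeE : ∀ {ls rs} → All (Valued S) (toList ls) → All (Valued S) (toList rs)
         → Valued S (nodeE ls rs)
  vnodeO : ∀ {ls rs} → All (Valued S) (toList ls) → All (Valued S) (toList rs)
         → Valued S (nodeO ls rs)

mutual
  ext : (ℤ → ℤ) → ∀ {p} → Game p → Game p
  ext f (int n)       = int (f n)
  ext f (nodeE ls rs) = nodeE (ext⁺ f ls) (ext⁺ f rs)
  ext f (nodeO ls rs) = nodeO (ext⁺ f ls) (ext⁺ f rs)

  ext⁺ : (ℤ → ℤ) → ∀ {p} → List⁺ (Game p) → List⁺ (Game p)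
  ext⁺ f (g ∷ gs) = ext f g ∷ extL f gs

  extL : (ℤ → ℤ) → ∀ {p} → List (Game p) → List (Game p)
  extL f []       = []
  extL f (g ∷ gs) = ext f g ∷ extL f gs

-- f is the order-preserving bijection from S onto T
-- (f is a function on ℤ; only its values on S matter).
record OrderBijection (S T : List ℤ) (f : ℤ → ℤ) : Set where
  field
    maps-into  : ∀ {s} → s ∈ S → f s ∈ T
    monotone   : ∀ {s s'} → s ∈ S → s' ∈ S → s < s' → f s < f s'
    onto       : ∀ {t} → t ∈ T → Σ ℤ (λ s → (s ∈ S) × (f s ≡ t))

-- For a threshold t and a game X, the S-values s with t ≤ f s + x form an up-set of S
-- whenever f is monotone on S, so they are exactly the s ≥ c for some c = c(t, x).
-- Hence, with shiftₜ x = - c(t, x), the leaf f s + x of f̃ G + X clears t exactly when the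
-- leaf s + shiftₜ x of G + shift̃ₜ X clears 0. Outcomes are iterated max/min of leaves, which
-- respect such threshold agreement, so t ≤ L(f̃ G + X) iff 0 ≤ L(G + shift̃ₜ X), and
-- likewise for R. As shift̃ₜ X does not depend on G, f̃ preserves ≈. The inverse of the
-- order bijection is monotone on T, so f̃⁻¹ preserves ≈ as well; since f̃⁻¹ ∘ f̃ and
-- f̃ ∘ f̃⁻¹ are identities on S- resp. T-valued games, f̃ reflects ≈ and is onto.
module Submission where

open import Defs
open import Data.Empty using (⊥-elim)
open import Data.Integer using (ℤ; _≤_; _<_; -_; _-_; 0ℤ) renaming (suc to sucℤ; _+_ to _+ℤ_)
open import Data.Integer.Base using (_⊔_; _⊓_)
import Data.Integer.Properties as ℤP
open import Data.List using (List; []; _∷_; length; _++_)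
open import Data.List.NonEmpty using (List⁺; _∷_; toList)
open import Data.List.Relation.Unary.All using (All; []; _∷_)
open import Data.List.Relation.Unary.Any using (here; there)
open import Data.List.Relation.Unary.Unique.Propositional using (Unique)
open import Data.List.Membership.Propositional using (_∈_)
open import Data.List.Membership.DecPropositional ℤP._≟_ using (_∈?_)
open import Data.Product using (_×_; Σ; _,_; proj₁; proj₂)
open import Data.Product.Function.NonDependent.Propositional using (_×-⇔_)
open import Data.Sum using (_⊎_; inj₁; inj₂; [_,_])
open import Data.Sum.Function.Propositional using (_⊎-⇔_)
open import Function.Bundles using (_⇔_; mk⇔; Equivalence)
open import Function.Construct.Composition using (_⇔-∘_)
open import Function.Construct.Symmetry using (⇔-sym)
open import Relation.Binary.PropositionalEquality
  using (_≡_; refl; sym; cong; cong₂; subst; subst₂)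
open import Relation.Binary.Definitions using (tri<; tri≈; tri>)
open import Relation.Nullary using (yes; no)
open import Relation.Unary using (Decidable)

open Equivalence using (to; from)

module _ (R : ℤ → ℤ → Set) where
  mutual
    data Pointwise : ∀ {p} → Game p → Game p → Set where
      int   : ∀ {a b} → R a b → Pointwise (int a) (int b)
      nodeE : ∀ {ls rs ls′ rs′} → Pointwise⁺ ls ls′ → Pointwise⁺ rs rs′ →
              Pointwise (nodeE ls rs) (nodeE ls′ rs′)
      nodeO : ∀ {ls rs ls′ rs′} → Pointwise⁺ ls ls′ → Pointwise⁺ rs rs′ →
              Pointwise (nodeO ls rs) (nodeO ls′ rs′)

    data Pointwise⁺ {p} : List⁺ (Game p) → List⁺ (Game p) → Set where
      _∷_ : ∀ {g g′ gs gs′} → Pointwise g g′ → PointwiseL gs gs′ →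
            Pointwise⁺ (g ∷ gs) (g′ ∷ gs′)

    data PointwiseL {p} : List (Game p) → List (Game p) → Set where
      []  : PointwiseL [] []
      _∷_ : ∀ {g g′ gs gs′} → Pointwise g g′ → PointwiseL gs gs′ →
            PointwiseL (g ∷ gs) (g′ ∷ gs′)

module _ {R : ℤ → ℤ → Set}
  (⊔-pres : ∀ {a b c d} → R a b → R c d → R (a ⊔ c) (b ⊔ d))
  (⊓-pres : ∀ {a b c d} → R a b → R c d → R (a ⊓ c) (b ⊓ d)) where
  mutual
    Lo-pointwise : ∀ {p} {G H : Game p} → Pointwise R G H → R (Lo G) (Lo H)
    Lo-pointwise (int r)      = r
    Lo-pointwise (nodeE ls _) = maxR-pointwise ls
    Lo-pointwise (nodeO ls _) = maxR-pointwise ls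

    Ro-pointwise : ∀ {p} {G H : Game p} → Pointwise R G H → R (Ro G) (Ro H)
    Ro-pointwise (int r)      = r
    Ro-pointwise (nodeE _ rs) = minL-pointwise rs
    Ro-pointwise (nodeO _ rs) = minL-pointwise rs

    maxR-pointwise : ∀ {p} {gs hs : List⁺ (Game p)} →
                     Pointwise⁺ R gs hs → R (maxR gs) (maxR hs)
    maxR-pointwise (g ∷ gs) = maxR′-pointwise (Ro-pointwise g) gs

    maxR′-pointwise : ∀ {p a b} {gs hs : List (Game p)} →
                      R a b → PointwiseL R gs hs → R (maxR' a gs) (maxR' b hs)
    maxR′-pointwise r []       = r
    maxR′-pointwise r (g ∷ gs) = maxR′-pointwise (⊔-pres r (Ro-pointwise g)) gs

    minL-pointwise : ∀ {p} {gs hs : List⁺ (Game p)} →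
                     Pointwise⁺ R gs hs → R (minL gs) (minL hs)
    minL-pointwise (g ∷ gs) = minL′-pointwise (Lo-pointwise g) gs

    minL′-pointwise : ∀ {p a b} {gs hs : List (Game p)} →
                      R a b → PointwiseL R gs hs → R (minL' a gs) (minL' b hs)
    minL′-pointwise r []       = r
    minL′-pointwise r (g ∷ gs) = minL′-pointwise (⊓-pres r (Lo-pointwise g)) gs

module _ {R : ℤ → ℤ → Set} where
  ++-pointwise : ∀ {p} {as bs cs ds : List (Game p)} →
                 PointwiseL R as bs → PointwiseL R cs ds → PointwiseL R (as ++ cs) (bs ++ ds)
  ++-pointwise []       qs = qs
  ++-pointwise (p ∷ ps) qs = p ∷ ++-pointwise ps qs

  ⁺++⁺-pointwise : ∀ {p} {as bs cs ds : List⁺ (Game p)} →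
                   Pointwise⁺ R as bs → Pointwise⁺ R cs ds →
                   Pointwise⁺ R (as ⁺++⁺ cs) (bs ⁺++⁺ ds)
  ⁺++⁺-pointwise (p ∷ ps) (q ∷ qs) = p ∷ ++-pointwise ps (q ∷ qs)

module _ {R₁ R₂ R : ℤ → ℤ → Set}
  (+-pres : ∀ {a b x y} → R₁ a b → R₂ x y → R (a +ℤ x) (b +ℤ y)) where
  mutual
    +G-pointwise : ∀ {p q} {G G′ : Game p} {X X′ : Game q} →
                   Pointwise R₁ G G′ → Pointwise R₂ X X′ → Pointwise R (G +G X) (G′ +G X′)
    +G-pointwise (int a) (int x) = int (+-pres a x)
    +G-pointwise g@(int _) (nodeE ls rs) = nodeE (mapʳ-pointwise g ls) (mapʳ-pointwise g rs)
    +G-pointwise g@(int _) (nodeO ls rs) = nodeO (mapʳ-pointwise g ls) (mapʳ-pointwise g rs)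
    +G-pointwise (nodeE ls rs) x@(int _) = nodeE (mapˡ-pointwise ls x) (mapˡ-pointwise rs x)
    +G-pointwise (nodeO ls rs) x@(int _) = nodeO (mapˡ-pointwise ls x) (mapˡ-pointwise rs x)
    +G-pointwise g@(nodeE ls rs) x@(nodeE ks ts) =
      nodeE (⁺++⁺-pointwise (mapˡ-pointwise ls x) (mapʳ-pointwise g ks))
            (⁺++⁺-pointwise (mapˡ-pointwise rs x) (mapʳ-pointwise g ts))
    +G-pointwise g@(nodeE ls rs) x@(nodeO ks ts) =
      nodeO (⁺++⁺-pointwise (mapˡ-pointwise ls x) (mapʳ-pointwise g ks))
            (⁺++⁺-pointwise (mapˡ-pointwise rs x) (mapʳ-pointwise g ts))
    +G-pointwise g@(nodeO ls rs) x@(nodeE ks ts) =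
      nodeO (⁺++⁺-pointwise (mapˡ-pointwise ls x) (mapʳ-pointwise g ks))
            (⁺++⁺-pointwise (mapˡ-pointwise rs x) (mapʳ-pointwise g ts))
    +G-pointwise g@(nodeO ls rs) x@(nodeO ks ts) =
      nodeE (⁺++⁺-pointwise (mapˡ-pointwise ls x) (mapʳ-pointwise g ks))
            (⁺++⁺-pointwise (mapˡ-pointwise rs x) (mapʳ-pointwise g ts))

    mapˡ-pointwise : ∀ {p q} {gs gs′ : List⁺ (Game p)} {X X′ : Game q} →
                     Pointwise⁺ R₁ gs gs′ → Pointwise R₂ X X′ →
                     Pointwise⁺ R (mapˡ gs X) (mapˡ gs′ X′)
    mapˡ-pointwise (g ∷ gs) x = +G-pointwise g x ∷ mapˡ′-pointwise gs x

    mapˡ′-pointwise : ∀ {p q} {gs gs′ : List (Game p)} {X X′ : Game q} →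
                      PointwiseL R₁ gs gs′ → Pointwise R₂ X X′ →
                      PointwiseL R (mapˡ' gs X) (mapˡ' gs′ X′)
    mapˡ′-pointwise []       x = []
    mapˡ′-pointwise (g ∷ gs) x = +G-pointwise g x ∷ mapˡ′-pointwise gs x

    mapʳ-pointwise : ∀ {p q} {G G′ : Game p} {xs xs′ : List⁺ (Game q)} →
                     Pointwise R₁ G G′ → Pointwise⁺ R₂ xs xs′ →
                     Pointwise⁺ R (mapʳ G xs) (mapʳ G′ xs′)
    mapʳ-pointwise g (x ∷ xs) = +G-pointwise g x ∷ mapʳ′-pointwise g xs

    mapʳ′-pointwise : ∀ {p q} {G G′ : Game p} {xs xs′ : List (Game q)} →
                      Pointwise R₁ G G′ → PointwiseL R₂ xs xs′ →
                      PointwiseL R (mapʳ' G xs) (mapʳ' G′ xs′)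
    mapʳ′-pointwise g []       = []
    mapʳ′-pointwise g (x ∷ xs) = +G-pointwise g x ∷ mapʳ′-pointwise g xs

module _ {S : List ℤ} where
  mutual
    ext-pointwise : ∀ {R f p} {G : Game p} → (∀ {s} → s ∈ S → R (f s) s) →
                    Valued S G → Pointwise R (ext f G) G
    ext-pointwise r (vint s∈S)    = int (r s∈S)
    ext-pointwise r (vnodeE ls rs) = nodeE (ext⁺-pointwise r ls) (ext⁺-pointwise r rs)
    ext-pointwise r (vnodeO ls rs) = nodeO (ext⁺-pointwise r ls) (ext⁺-pointwise r rs)

    ext⁺-pointwise : ∀ {R f p} {gs : List⁺ (Game p)} → (∀ {s} → s ∈ S → R (f s) s) →
                     All (Valued S) (toList gs) → Pointwise⁺ R (ext⁺ f gs) gs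
    ext⁺-pointwise r (v ∷ vs) = ext-pointwise r v ∷ extL-pointwise r vs

    extL-pointwise : ∀ {R f p} {gs : List (Game p)} → (∀ {s} → s ∈ S → R (f s) s) →
                     All (Valued S) gs → PointwiseL R (extL f gs) gs
    extL-pointwise r []       = []
    extL-pointwise r (v ∷ vs) = ext-pointwise r v ∷ extL-pointwise r vs

  mutual
    ext-valued : ∀ {T f p} {G : Game p} → (∀ {s} → s ∈ S → f s ∈ T) →
                 Valued S G → Valued T (ext f G)
    ext-valued into (vint s∈S)     = vint (into s∈S)
    ext-valued into (vnodeE ls rs) = vnodeE (ext⁺-valued into ls) (ext⁺-valued into rs)
    ext-valued into (vnodeO ls rs) = vnodeO (ext⁺-valued into ls) (ext⁺-valued into rs)

    ext⁺-valued : ∀ {T f p} {gs : List⁺ (Game p)} → (∀ {s} → s ∈ S → f s ∈ T) →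
                  All (Valued S) (toList gs) → All (Valued T) (toList (ext⁺ f gs))
    ext⁺-valued into (v ∷ vs) = ext-valued into v ∷ extL-valued into vs

    extL-valued : ∀ {T f p} {gs : List (Game p)} → (∀ {s} → s ∈ S → f s ∈ T) →
                  All (Valued S) gs → All (Valued T) (extL f gs)
    extL-valued into []       = []
    extL-valued into (v ∷ vs) = ext-valued into v ∷ extL-valued into vs

  mutual
    ext-inverse : ∀ {f g p} {G : Game p} → (∀ {s} → s ∈ S → g (f s) ≡ s) →
                  Valued S G → ext g (ext f G) ≡ G
    ext-inverse gf (vint s∈S)     = cong int (gf s∈S)
    ext-inverse gf (vnodeE ls rs) = cong₂ nodeE (ext⁺-inverse gf ls) (ext⁺-inverse gf rs)
    ext-inverse gf (vnodeO ls rs) = cong₂ nodeO (ext⁺-inverse gf ls) (ext⁺-inverse gf rs)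

    ext⁺-inverse : ∀ {f g p} {gs : List⁺ (Game p)} → (∀ {s} → s ∈ S → g (f s) ≡ s) →
                   All (Valued S) (toList gs) → ext⁺ g (ext⁺ f gs) ≡ gs
    ext⁺-inverse gf (v ∷ vs) = cong₂ _∷_ (ext-inverse gf v) (extL-inverse gf vs)

    extL-inverse : ∀ {f g p} {gs : List (Game p)} → (∀ {s} → s ∈ S → g (f s) ≡ s) →
                   All (Valued S) gs → extL g (extL f gs) ≡ gs
    extL-inverse gf []       = refl
    extL-inverse gf (v ∷ vs) = cong₂ _∷_ (ext-inverse gf v) (extL-inverse gf vs)

mutual
  pointwise-ext : ∀ {R f p} → (∀ x → R x (f x)) → (X : Game p) → Pointwise R X (ext f X)
  pointwise-ext r (int x)       = int (r x)
  pointwise-ext r (nodeE ls rs) = nodeE (pointwise-ext⁺ r ls) (pointwise-ext⁺ r rs)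
  pointwise-ext r (nodeO ls rs) = nodeO (pointwise-ext⁺ r ls) (pointwise-ext⁺ r rs)

  pointwise-ext⁺ : ∀ {R f p} → (∀ x → R x (f x)) → (xs : List⁺ (Game p)) →
                   Pointwise⁺ R xs (ext⁺ f xs)
  pointwise-ext⁺ r (x ∷ xs) = pointwise-ext r x ∷ pointwise-extL r xs

  pointwise-extL : ∀ {R f p} → (∀ x → R x (f x)) → (xs : List (Game p)) →
                   PointwiseL R xs (extL f xs)
  pointwise-extL r []       = []
  pointwise-extL r (x ∷ xs) = pointwise-ext r x ∷ pointwise-extL r xs

≈G-refl : ∀ {p} {G : Game p} → G ≈G G
≈G-refl X = refl , refl

≤-⊔-⇔ : ∀ {t a b} → t ≤ a ⊔ b ⇔ (t ≤ a ⊎ t ≤ b)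
≤-⊔-⇔ {t} {a} {b} = mk⇔ split [ ℤP.i≤j⇒i≤j⊔k b , ℤP.i≤j⇒i≤k⊔j a ]
  where
  split : t ≤ a ⊔ b → t ≤ a ⊎ t ≤ b
  split t≤ with ℤP.⊔-sel a b
  ... | inj₁ a⊔b≡a = inj₁ (subst (t ≤_) a⊔b≡a t≤)
  ... | inj₂ a⊔b≡b = inj₂ (subst (t ≤_) a⊔b≡b t≤)

≤-⊓-⇔ : ∀ {t a b} → t ≤ a ⊓ b ⇔ (t ≤ a × t ≤ b)
≤-⊓-⇔ {a = a} {b} = mk⇔ (λ t≤ → ℤP.i≤j⊓k⇒i≤j a b t≤ , ℤP.i≤j⊓k⇒i≤k a b t≤)
                         (λ (t≤a , t≤b) → ℤP.⊓-glb t≤a t≤b)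

⊓-≤-⇔ : ∀ {a b t} → a ⊓ b ≤ t ⇔ (a ≤ t ⊎ b ≤ t)
⊓-≤-⇔ {a} {b} {t} = mk⇔ split [ ℤP.i≤j⇒i⊓k≤j b , ℤP.i≤j⇒k⊓i≤j a ]
  where
  split : a ⊓ b ≤ t → a ≤ t ⊎ b ≤ t
  split ≤t with ℤP.⊓-sel a b
  ... | inj₁ a⊓b≡a = inj₁ (subst (_≤ t) a⊓b≡a ≤t)
  ... | inj₂ a⊓b≡b = inj₂ (subst (_≤ t) a⊓b≡b ≤t)

⊔-≤-⇔ : ∀ {a b t} → a ⊔ b ≤ t ⇔ (a ≤ t × b ≤ t)
⊔-≤-⇔ {a} {b} = mk⇔ (λ ≤t → ℤP.i⊔j≤k⇒i≤k a b ≤t , ℤP.i⊔j≤k⇒j≤k a b ≤t)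
                     (λ (a≤ , b≤) → ℤP.⊔-lub a≤ b≤)

≤⇔0≤- : ∀ {c s} → c ≤ s ⇔ 0ℤ ≤ s - c
≤⇔0≤- = mk⇔ ℤP.i≤j⇒0≤j-i ℤP.0≤i-j⇒j≤i

≡-from-≤-⇔ : ∀ {a b} → (∀ t → t ≤ a ⇔ t ≤ b) → a ≡ b
≡-from-≤-⇔ {a} {b} a≈b = ℤP.≤-antisym (to (a≈b a) ℤP.≤-refl) (from (a≈b b) ℤP.≤-refl)

SameSide : ℤ → ℤ → ℤ → ℤ → Set
SameSide t u a b = t ≤ a ⇔ u ≤ b

⊔-sameSide : ∀ {t u a b c d} → SameSide t u a b → SameSide t u c d →
             SameSide t u (a ⊔ c) (b ⊔ d)
⊔-sameSide a~b c~d = ⇔-sym ≤-⊔-⇔ ⇔-∘ ((a~b ⊎-⇔ c~d) ⇔-∘ ≤-⊔-⇔)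

⊓-sameSide : ∀ {t u a b c d} → SameSide t u a b → SameSide t u c d →
             SameSide t u (a ⊓ c) (b ⊓ d)
⊓-sameSide a~b c~d = ⇔-sym ≤-⊓-⇔ ⇔-∘ ((a~b ×-⇔ c~d) ⇔-∘ ≤-⊓-⇔)

UpwardClosedOn : List ℤ → (ℤ → Set) → Set
UpwardClosedOn S P = ∀ {a b} → a ∈ S → b ∈ S → a ≤ b → P a → P b

upwardClosed⇒threshold : ∀ (S : List ℤ) {P : ℤ → Set} → Decidable P → UpwardClosedOn S P →
                         Σ ℤ λ c → ∀ {s} → s ∈ S → P s ⇔ c ≤ s
upwardClosed⇒threshold [] P? up = 0ℤ , λ ()
-- A new head s either satisfies P, and then lowers the threshold to at most s, or it
-- does not, and then every element above the threshold must lie strictly above s.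
upwardClosed⇒threshold (s ∷ S) P? up
  with upwardClosed⇒threshold S P? (λ a∈S b∈S → up (there a∈S) (there b∈S)) | P? s
... | c , cut | yes Ps = s ⊓ c , λ where
  (here refl)  → mk⇔ (λ _ → ℤP.i⊓j≤i s c) (λ _ → Ps)
  (there x∈S) → mk⇔ (λ Px → from ⊓-≤-⇔ (inj₂ (to (cut x∈S) Px)))
                     (λ ≤x → [ (λ s≤x → up (here refl) (there x∈S) s≤x Ps) , from (cut x∈S) ]
                               (to ⊓-≤-⇔ ≤x))
... | c , cut | no ¬Ps = sucℤ s ⊔ c , λ where
  (here refl)  → mk⇔ (λ Ps → ⊥-elim (¬Ps Ps))
                     (λ ≤s → ⊥-elim (ℤP.<-irrefl refl
                                       (ℤP.suc[i]≤j⇒i<j (proj₁ (to ⊔-≤-⇔ ≤s)))))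
  (there x∈S) → mk⇔ (λ Px → from ⊔-≤-⇔ (ℤP.i<j⇒suc[i]≤j (ℤP.≰⇒> (λ x≤s →
                                           ¬Ps (up (there x∈S) (here refl) x≤s Px)))
                                         , to (cut x∈S) Px))
                     (λ ≤x → from (cut x∈S) (proj₂ (to ⊔-≤-⇔ ≤x)))

module MonotoneExtension (S : List ℤ) (f : ℤ → ℤ)
  (monotone : ∀ {s s′} → s ∈ S → s′ ∈ S → s ≤ s′ → f s ≤ f s′) where

  threshold : ∀ t x → Σ ℤ λ c → ∀ {s} → s ∈ S → t ≤ f s +ℤ x ⇔ c ≤ s
  threshold t x = upwardClosed⇒threshold S {λ s → t ≤ f s +ℤ x} (λ s → t ℤP.≤? f s +ℤ x)
    (λ a∈S b∈S a≤b t≤ → ℤP.≤-trans t≤ (ℤP.+-monoˡ-≤ x (monotone a∈S b∈S a≤b)))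

  shift : ℤ → ℤ → ℤ
  shift t x = - proj₁ (threshold t x)

  sum-sameSide : ∀ t {p q} {G : Game p} → Valued S G → (X : Game q) →
                 Pointwise (SameSide t 0ℤ) (ext f G +G X) (G +G ext (shift t) X)
  sum-sameSide t vG X =
    +G-pointwise {R₁ = λ a b → b ∈ S × a ≡ f b} {R₂ = λ x y → y ≡ shift t x}
      leaf (ext-pointwise (λ s∈S → s∈S , refl) vG) (pointwise-ext (λ _ → refl) X)
    where
    leaf : ∀ {a b x y} → b ∈ S × a ≡ f b → y ≡ shift t x → SameSide t 0ℤ (a +ℤ x) (b +ℤ y)
    leaf {x = x} (b∈S , refl) refl = ≤⇔0≤- ⇔-∘ proj₂ (threshold t x) b∈S

  Lo-sameSide : ∀ t {p q} {G : Game p} → Valued S G → (X : Game q) →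
                SameSide t 0ℤ (Lo (ext f G +G X)) (Lo (G +G ext (shift t) X))
  Lo-sameSide t vG X = Lo-pointwise ⊔-sameSide ⊓-sameSide (sum-sameSide t vG X)

  Ro-sameSide : ∀ t {p q} {G : Game p} → Valued S G → (X : Game q) →
                SameSide t 0ℤ (Ro (ext f G +G X)) (Ro (G +G ext (shift t) X))
  Ro-sameSide t vG X = Ro-pointwise ⊔-sameSide ⊓-sameSide (sum-sameSide t vG X)

  ext-preserves-≈ : ∀ {p q} {G : Game p} {H : Game q} → Valued S G → Valued S H →
                    G ≈G H → ext f G ≈G ext f H
  ext-preserves-≈ vG vH G≈H X =
      ≡-from-≤-⇔ (λ t → bridge (Lo-sameSide t vG X) (Lo-sameSide t vH X)
                                (proj₁ (G≈H (ext (shift t) X))))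
    , ≡-from-≤-⇔ (λ t → bridge (Ro-sameSide t vG X) (Ro-sameSide t vH X)
                                (proj₂ (G≈H (ext (shift t) X))))
    where
    bridge : ∀ {t a b a′ b′} → SameSide t 0ℤ a a′ → SameSide t 0ℤ b b′ → a′ ≡ b′ →
             t ≤ a ⇔ t ≤ b
    bridge a~a′ b~b′ refl = ⇔-sym b~b′ ⇔-∘ a~a′

strictlyMonotone⇒monotone : ∀ {S : List ℤ} {f : ℤ → ℤ} →
  (∀ {s s′} → s ∈ S → s′ ∈ S → s < s′ → f s < f s′) →
  ∀ {s s′} → s ∈ S → s′ ∈ S → s ≤ s′ → f s ≤ f s′
strictlyMonotone⇒monotone mono {s} {s′} s∈S s′∈S s≤s′ with ℤP.<-cmp s s′
... | tri< s<s′ _ _ = ℤP.<⇒≤ (mono s∈S s′∈S s<s′)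
... | tri≈ _ refl _ = ℤP.≤-refl
... | tri> _ _ s′<s = ⊥-elim (ℤP.<⇒≱ s′<s s≤s′)

module OrderBijectionInverse {S T : List ℤ} {f : ℤ → ℤ} (ob : OrderBijection S T f) where
  open OrderBijection ob

  f-injective : ∀ {s s′} → s ∈ S → s′ ∈ S → f s ≡ f s′ → s ≡ s′
  f-injective s∈S s′∈S fs≡fs′ = ℤP.≤-antisym
    (ℤP.≮⇒≥ λ s′<s → ℤP.<-irrefl (sym fs≡fs′) (monotone s′∈S s∈S s′<s))
    (ℤP.≮⇒≥ λ s<s′ → ℤP.<-irrefl fs≡fs′ (monotone s∈S s′∈S s<s′))

  -- Off T the value 0ℤ is junk; only the values on T are ever used.
  f⁻¹ : ℤ → ℤ
  f⁻¹ t with t ∈? T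
  ... | yes t∈T = proj₁ (onto t∈T)
  ... | no _    = 0ℤ

  f⁻¹-spec : ∀ {t} → t ∈ T → f⁻¹ t ∈ S × f (f⁻¹ t) ≡ t
  f⁻¹-spec {t} t∈T with t ∈? T
  ... | yes t∈T′ = proj₂ (onto t∈T′)
  ... | no t∉T   = ⊥-elim (t∉T t∈T)

  f⁻¹-∈ : ∀ {t} → t ∈ T → f⁻¹ t ∈ S
  f⁻¹-∈ t∈T = proj₁ (f⁻¹-spec t∈T)

  f-f⁻¹ : ∀ {t} → t ∈ T → f (f⁻¹ t) ≡ t
  f-f⁻¹ t∈T = proj₂ (f⁻¹-spec t∈T)

  f⁻¹-f : ∀ {s} → s ∈ S → f⁻¹ (f s) ≡ s
  f⁻¹-f s∈S = f-injective (f⁻¹-∈ (maps-into s∈S)) s∈S (f-f⁻¹ (maps-into s∈S))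

  f⁻¹-monotone : ∀ {t t′} → t ∈ T → t′ ∈ T → t ≤ t′ → f⁻¹ t ≤ f⁻¹ t′
  f⁻¹-monotone t∈T t′∈T t≤t′ = ℤP.≮⇒≥ λ lt → ℤP.<⇒≱
    (subst₂ _<_ (f-f⁻¹ t′∈T) (f-f⁻¹ t∈T) (monotone (f⁻¹-∈ t′∈T) (f⁻¹-∈ t∈T) lt)) t≤t′

-- Strict monotonicity already makes f injective on S.
mainTheorem20 : (S T : List ℤ) → Unique S → Unique T → length S ≡ length T →
    (f : ℤ → ℤ) → OrderBijection S T f →
    ((∀ {p q} (G : Game p) (H : Game q) → Valued S G → Valued S H →
        (G ≈G H → ext f G ≈G ext f H) × (ext f G ≈G ext f H → G ≈G H))
    × (∀ {q} (K : Game q) → Valued T K →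
        Σ Temper (λ p → Σ (Game p) (λ G → Valued S G × (ext f G ≈G K)))))
mainTheorem20 S T _ _ _ f ob = (λ G H vG vH → F.ext-preserves-≈ vG vH , reflects vG vH) , onto-≈
  where
  open OrderBijection ob
  open OrderBijectionInverse ob
  module F   = MonotoneExtension S f (strictlyMonotone⇒monotone monotone)
  module F⁻¹ = MonotoneExtension T f⁻¹ f⁻¹-monotone

  reflects : ∀ {p q} {G : Game p} {H : Game q} → Valued S G → Valued S H →
             ext f G ≈G ext f H → G ≈G H
  reflects vG vH fG≈fH = subst₂ _≈G_ (ext-inverse f⁻¹-f vG) (ext-inverse f⁻¹-f vH)
    (F⁻¹.ext-preserves-≈ (ext-valued maps-into vG) (ext-valued maps-into vH) fG≈fH)

  onto-≈ : ∀ {q} (K : Game q) → Valued T K →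
           Σ Temper (λ p → Σ (Game p) (λ G → Valued S G × (ext f G ≈G K)))
  onto-≈ {q} K vK = q , ext f⁻¹ K , ext-valued f⁻¹-∈ vK ,
    subst (_≈G K) (sym (ext-inverse f-f⁻¹ vK)) (≈G-refl {G = K})
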